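{- Let $(l_k)_{k\in K}$ be pairwise distinct labels and let $I,J\subseteq K$ be finite, with types $\sigma_i\in\mathbb{T}$ ($i\in I$) and $\tau_j\in\mathbb{T}$ ($j\in J$). Then: (a) $\langle l_i:\sigma_i\mid i\in I\rangle\le\langle l_j:\tau_j\mid j\in J\rangle$ if and only if $J\subseteq I$ and $\sigma_j\le\tau_j$ for all $j\in J$; (b) $\langle l_i:\sigma_i\mid i\in I\rangle\cap\langle l_j:\tau_j\mid j\in J\rangle=\langle l_i:\sigma_i,\,l_j:\tau_j,\,l_k:\sigma_k\cap\tau_k\mid i\in I\setminus J,\ j\in J\setminus I,\ k\in I\cap J\rangle$; (c) $\langle l_i:\sigma_i\mid i\in I\rangle+\langle l_j:\tau_j\mid j\in J\rangle=\langle l_i:\sigma_i,\,l_j:\tau_j\mid i\in I\setminus J,\ j\in J\rangle$; (d) for every $\rho\in\mathbb{T}_R$ there exist finitely many pairwise distinct labels $l_i$ and types $\sigma_i$ ($i\in I$) with $\rho=\langle l_i:\sigma_i\mid i\in I\rangle$.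
   Context: Types $\mathbb{T}$: $\sigma::=a\mid\omega\mid\sigma\to\sigma\mid\sigma\cap\sigma\mid\rho$; record types $\mathbb{T}_R$: $\rho::=\langle\rangle\mid\langle l:\sigma\rangle\mid\rho+\rho\mid\rho\cap\rho$. Subtyping $\le$ is the least preorder with: $\sigma\le\omega$; $\omega\le\omega\to\omega$; $\sigma\cap\tau\le\sigma$; $\sigma\cap\tau\le\tau$; $\sigma\le\tau_1,\sigma\le\tau_2\Rightarrow\sigma\le\tau_1\cap\tau_2$; $(\sigma\to\tau_1)\cap(\sigma\to\tau_2)\le\sigma\to\tau_1\cap\tau_2$; $\sigma_2\le\sigma_1,\tau_1\le\tau_2\Rightarrow\sigma_1\to\tau_1\le\sigma_2\to\tau_2$; $\langle l:\sigma\rangle\le\langle\rangle$; $\langle l:\sigma\rangle\cap\langle l:\tau\rangle\le\langle l:\sigma\cap\tau\rangle$; $\sigma\le\tau\Rightarrow\langle l:\sigma\rangle\le\langle l:\tau\rangle$; and, with $\sigma=\tau$ meaning $\sigma\le\tau$ and $\tau\le\sigma$: $\rho+\langle\rangle=\langle\rangle+\rho=\rho$; $(\rho_1+\rho_2)+\rho_3=\rho_1+(\rho_2+\rho_3)$; $(\rho_1\cap\rho_2)+\rho_3=(\rho_1+\rho_3)\cap(\rho_2+\rho_3)$; $\langle l:\sigma\rangle+(\langle l:\tau\rangle\cap\rho)=\langle l:\tau\rangle\cap\rho$; $\langle l:\sigma\rangle+(\langle l':\tau\rangle\cap\rho)=\langle l':\tau\rangle\cap(\langle l:\sigma\rangle+\rho)$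 if $l\ne l'$; $\rho_1\le\rho_2\Rightarrow\rho_1+\rho\le\rho_2+\rho$; $\rho_1=\rho_2\Rightarrow\rho+\rho_1=\rho+\rho_2$. Notation: for pairwise distinct labels, $\langle l_i:\sigma_i\mid i\in I\rangle$ abbreviates $\bigcap_{i\in I}\langle l_i:\sigma_i\rangle$ if $I\ne\emptyset$ and $\langle\rangle$ if $I=\emptyset$; listing several families inside one record bracket means the record over the union of the index sets. -}

module Defs where

open import Data.Nat using (ℕ) renaming (_≟_ to _≟ℕ_)
open import Data.Product using (_×_; _,_; proj₁; proj₂)
open import Data.List using (List; []; _∷_; filter; map; _++_)
open import Relation.Binary.PropositionalEquality using (_≡_; _≢_; cong)
open import Relation.Binary.Definitions using (DecidableEquality)
open import Relation.Nullary using (yes; no; ¬?)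
open import Function.Definitions using (Injective)
import Data.List.Membership.DecPropositional as DecMem

Label : Set
Label = ℕ

-- Raw syntax; membership in 𝕋 / 𝕋_R is carried by the predicates IsT / IsR below.
infixr 6 _⇒_
infixl 7 _∩_
infixl 8 _+_
data Ty : Set where
  atom  : ℕ → Ty
  ω     : Ty
  _⇒_   : Ty → Ty → Ty
  _∩_   : Ty → Ty → Ty
  ⟨⟩    : Ty
  ⟨_∶_⟩ : Label → Ty → Ty
  _+_   : Ty → Ty → Ty

mutual
  data IsT : Ty → Set where
    atomT : ∀ a → IsT (atom a)
    ωT    : IsT ω
    ⇒T    : ∀ {σ τ} → IsT σ → IsT τ → IsT (σ ⇒ τ)
    ∩T    : ∀ {σ τ} → IsT σ → IsT τ → IsT (σ ∩ τ)
    recT  : ∀ {ρ} → IsR ρ → IsT ρ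

  data IsR : Ty → Set where
    ⟨⟩R  : IsR ⟨⟩
    fldR : ∀ l {σ} → IsT σ → IsR ⟨ l ∶ σ ⟩
    +R   : ∀ {ρ₁ ρ₂} → IsR ρ₁ → IsR ρ₂ → IsR (ρ₁ + ρ₂)
    ∩R   : ∀ {ρ₁ ρ₂} → IsR ρ₁ → IsR ρ₂ → IsR (ρ₁ ∩ ρ₂)

data _≐_ : Ty → Ty → Set where
  +unitʳ : ∀ {ρ} → IsR ρ → (ρ + ⟨⟩) ≐ ρ
  +unitˡ : ∀ {ρ} → IsR ρ → (⟨⟩ + ρ) ≐ ρ
  +assoc : ∀ {ρ₁ ρ₂ ρ₃} → IsR ρ₁ → IsR ρ₂ → IsR ρ₃ →
           ((ρ₁ + ρ₂) + ρ₃) ≐ (ρ₁ + (ρ₂ + ρ₃))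
  +distr : ∀ {ρ₁ ρ₂ ρ₃} → IsR ρ₁ → IsR ρ₂ → IsR ρ₃ →
           ((ρ₁ ∩ ρ₂) + ρ₃) ≐ ((ρ₁ + ρ₃) ∩ (ρ₂ + ρ₃))
  +same  : ∀ {l σ τ ρ} → IsT σ → IsT τ → IsR ρ →
           (⟨ l ∶ σ ⟩ + (⟨ l ∶ τ ⟩ ∩ ρ)) ≐ (⟨ l ∶ τ ⟩ ∩ ρ)
  +diff  : ∀ {l l′ σ τ ρ} → l ≢ l′ → IsT σ → IsT τ → IsR ρ →
           (⟨ l ∶ σ ⟩ + (⟨ l′ ∶ τ ⟩ ∩ ρ)) ≐ (⟨ l′ ∶ τ ⟩ ∩ (⟨ l ∶ σ ⟩ + ρ))

infix 4 _≤_ _≅_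
data _≤_ : Ty → Ty → Set where
  ≤-refl  : ∀ {σ} → IsT σ → σ ≤ σ
  ≤-trans : ∀ {σ τ υ} → σ ≤ τ → τ ≤ υ → σ ≤ υ
  ≤-ω     : ∀ {σ} → IsT σ → σ ≤ ω
  ω≤ω⇒ω   : ω ≤ ω ⇒ ω
  ∩-lb₁   : ∀ {σ τ} → IsT σ → IsT τ → σ ∩ τ ≤ σ
  ∩-lb₂   : ∀ {σ τ} → IsT σ → IsT τ → σ ∩ τ ≤ τ
  ∩-glb   : ∀ {σ τ₁ τ₂} → σ ≤ τ₁ → σ ≤ τ₂ → σ ≤ τ₁ ∩ τ₂
  ⇒-∩     : ∀ {σ τ₁ τ₂} → IsT σ → IsT τ₁ → IsT τ₂ →
            (σ ⇒ τ₁) ∩ (σ ⇒ τ₂) ≤ σ ⇒ (τ₁ ∩ τ₂)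
  ⇒-mono  : ∀ {σ₁ σ₂ τ₁ τ₂} → σ₂ ≤ σ₁ → τ₁ ≤ τ₂ → σ₁ ⇒ τ₁ ≤ σ₂ ⇒ τ₂
  fld-⟨⟩  : ∀ {l σ} → IsT σ → ⟨ l ∶ σ ⟩ ≤ ⟨⟩
  fld-∩   : ∀ {l σ τ} → IsT σ → IsT τ → ⟨ l ∶ σ ⟩ ∩ ⟨ l ∶ τ ⟩ ≤ ⟨ l ∶ σ ∩ τ ⟩
  fld-mono : ∀ {l σ τ} → σ ≤ τ → ⟨ l ∶ σ ⟩ ≤ ⟨ l ∶ τ ⟩
  ax→     : ∀ {σ τ} → σ ≐ τ → σ ≤ τ
  ax←     : ∀ {σ τ} → σ ≐ τ → τ ≤ σ
  +-monoˡ : ∀ {ρ₁ ρ₂ ρ} → IsR ρ₁ → IsR ρ₂ → IsR ρ →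
            ρ₁ ≤ ρ₂ → ρ₁ + ρ ≤ ρ₂ + ρ
  +-congʳ : ∀ {ρ ρ₁ ρ₂} → IsR ρ → IsR ρ₁ → IsR ρ₂ →
            ρ₁ ≤ ρ₂ → ρ₂ ≤ ρ₁ → ρ + ρ₁ ≤ ρ + ρ₂

_≅_ : Ty → Ty → Set
σ ≅ τ = σ ≤ τ × τ ≤ σ

-- ⟨ l_i : σ_i | i ∈ I ⟩ given as a list of (label, type) entries:
-- ⟨⟩ if empty, otherwise the intersection of the single-field records.
recL : List (Label × Ty) → Ty
recL [] = ⟨⟩
recL ((l , σ) ∷ []) = ⟨ l ∶ σ ⟩
recL ((l , σ) ∷ x ∷ xs) = ⟨ l ∶ σ ⟩ ∩ recL (x ∷ xs)

entries : {K : Set} → (K → Label) → (K → Ty) → List K → List (Label × Ty)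
entries l σ I = map (λ i → (l i , σ i)) I

decInj : {K : Set} (l : K → Label) → Injective _≡_ _≡_ l → DecidableEquality K
decInj l inj x y with l x ≟ℕ l y
... | yes p = yes (inj p)
... | no ¬p = no (λ e → ¬p (cong l e))

-- I ∖ J and I ∩ J on finite index sets represented as duplicate-free lists
minus : {K : Set} → DecidableEquality K → List K → List K → List K
minus _≟_ I J = filter (λ i → ¬? (i ∈? J)) I
  where open DecMem _≟_

inter : {K : Set} → DecidableEquality K → List K → List K → List K
inter _≟_ I J = filter (λ i → i ∈? J) I
  where open DecMem _≟_

-- A sum ρ + ρ′ is pushed through the fields of ρ by distributivity, each field either
-- vanishing (its label occurs in ρ′) or commuting past ρ′; repeated labels are then fused
-- by ⟨ l ∶ σ ⟩ ∩ ⟨ l ∶ τ ⟩ = ⟨ l ∶ σ ∩ τ ⟩. A record ⟨ l_i ∶ σ_i | i ∈ I ⟩ is the greatest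
-- lower bound of ⟨⟩ and its fields, so comparing two of them reduces to comparing fields,
-- which gives (b), (c) and the "if" part of (a). For "only if", read every type as the
-- partial map sending a label to its field type: subtyping is sound for the pointwise
-- order of these maps in which an absent field is largest, and a record with distinct
-- labels denotes exactly its fields.

module Submission where

open import Defs
open import Data.Empty using (⊥; ⊥-elim)
open import Data.List using (List; []; _∷_; map; _++_; filter; foldr)
open import Data.List.Membership.Propositional using (_∈_; _∉_)
open import Data.List.Membership.Propositional.Properties
  using (∈-++⁻; ∈-++⁺ˡ; ∈-++⁺ʳ; ∈-map⁺; ∈-map⁻; ∈-filter⁺; ∈-filter⁻)
import Data.List.Membership.DecPropositional as DecMembership
open import Data.List.Properties using (filter-++; map-∘)
open import Data.List.Relation.Binary.Permutation.Propositional using (↭-refl; swap)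
open import Data.List.Relation.Binary.Subset.Propositional using (_⊆_)
open import Data.List.Relation.Binary.Subset.Propositional.Properties
  using (⊆-reflexive-↭; All-resp-⊇; xs⊆xs++ys; xs⊆ys++xs; ++⁺ˡ)
open import Data.List.Relation.Unary.All using (All; []; _∷_; tabulate)
import Data.List.Relation.Unary.All.Properties as All
open import Data.List.Relation.Unary.AllPairs using ([]; _∷_)
open import Data.List.Relation.Unary.Any using (here; there)
open import Data.List.Relation.Unary.Unique.Propositional using (Unique)
import Data.List.Relation.Unary.Unique.Propositional.Properties as Unique
open import Data.Maybe using (Maybe; just; nothing; _<∣>_)
import Data.Maybe as Maybe
open import Data.Maybe.Properties using (<∣>-assoc; <∣>-identityʳ)
import Data.Maybe.Relation.Unary.All as Maybeᴬ
open import Data.Nat using (_≟_)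
open import Data.Product using (_×_; _,_; Σ; ∃; proj₁; proj₂)
open import Data.Product.Properties using (,-injective)
open import Data.Sum using (inj₁; inj₂)
open import Data.Unit using (⊤; tt)
open import Function using (_∘_)
open import Function.Definitions using (Injective)
open import Relation.Binary.PropositionalEquality
  using (_≡_; _≢_; refl; sym; trans; cong; cong₂; subst; subst₂)
open import Relation.Nullary using (yes; no; ¬?)
open import Relation.Nullary.Decidable using (dec⇒maybe)
open import Relation.Binary.Definitions using (DecidableEquality)
open import Relation.Unary using (Decidable)

open DecMembership _≟_ using (_∈?_)

≐-isT : ∀ {σ τ} → σ ≐ τ → IsT σ × IsT τ
≐-isT (+unitʳ r)     = recT (+R r ⟨⟩R) , recT r
≐-isT (+unitˡ r)     = recT (+R ⟨⟩R r) , recT r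
≐-isT (+assoc a b c) = recT (+R (+R a b) c) , recT (+R a (+R b c))
≐-isT (+distr a b c) = recT (+R (∩R a b) c) , recT (∩R (+R a c) (+R b c))
≐-isT (+same {l = l} s t r) =
  recT (+R (fldR l s) (∩R (fldR l t) r)) , recT (∩R (fldR l t) r)
≐-isT (+diff {l = l} {l′ = l′} _ s t r) =
  recT (+R (fldR l s) (∩R (fldR l′ t) r)) , recT (∩R (fldR l′ t) (+R (fldR l s) r))

≤-isT : ∀ {σ τ} → σ ≤ τ → IsT σ × IsT τ
≤-isT (≤-refl s)           = s , s
≤-isT (≤-trans p q)        = proj₁ (≤-isT p) , proj₂ (≤-isT q)
≤-isT (≤-ω s)              = s , ωT
≤-isT ω≤ω⇒ω                = ωT , ⇒T ωT ωT
≤-isT (∩-lb₁ s t)          = ∩T s t , s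
≤-isT (∩-lb₂ s t)          = ∩T s t , t
≤-isT (∩-glb p q)          = proj₁ (≤-isT p) , ∩T (proj₂ (≤-isT p)) (proj₂ (≤-isT q))
≤-isT (⇒-∩ s t u)          = ∩T (⇒T s t) (⇒T s u) , ⇒T s (∩T t u)
≤-isT (⇒-mono p q)         =
  ⇒T (proj₂ (≤-isT p)) (proj₁ (≤-isT q)) , ⇒T (proj₁ (≤-isT p)) (proj₂ (≤-isT q))
≤-isT (fld-⟨⟩ {l = l} s)   = recT (fldR l s) , recT ⟨⟩R
≤-isT (fld-∩ {l = l} s t)  = recT (∩R (fldR l s) (fldR l t)) , recT (fldR l (∩T s t))
≤-isT (fld-mono {l = l} p) = recT (fldR l (proj₁ (≤-isT p))) , recT (fldR l (proj₂ (≤-isT p)))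
≤-isT (ax→ e)              = ≐-isT e
≤-isT (ax← e)              = proj₂ (≐-isT e) , proj₁ (≐-isT e)
≤-isT (+-monoˡ a b c _)    = recT (+R a c) , recT (+R b c)
≤-isT (+-congʳ a b c _ _)  = recT (+R a b) , recT (+R a c)

∩-mono : ∀ {σ σ′ τ τ′} → σ ≤ σ′ → τ ≤ τ′ → σ ∩ τ ≤ σ′ ∩ τ′
∩-mono {σ} {τ = τ} p q = ∩-glb (≤-trans (∩-lb₁ s t) p) (≤-trans (∩-lb₂ s t) q)
  where
  s : IsT σ
  s = proj₁ (≤-isT p)
  t : IsT τ
  t = proj₁ (≤-isT q)

≅-refl : ∀ {σ} → IsT σ → σ ≅ σ
≅-refl s = ≤-refl s , ≤-refl s

≅-sym : ∀ {σ τ} → σ ≅ τ → τ ≅ σ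
≅-sym (p , q) = q , p

≅-trans : ∀ {σ τ υ} → σ ≅ τ → τ ≅ υ → σ ≅ υ
≅-trans (p , p′) (q , q′) = ≤-trans p q , ≤-trans q′ p′

≐⇒≅ : ∀ {σ τ} → σ ≐ τ → σ ≅ τ
≐⇒≅ e = ax→ e , ax← e

∩-cong : ∀ {σ σ′ τ τ′} → σ ≅ σ′ → τ ≅ τ′ → σ ∩ τ ≅ σ′ ∩ τ′
∩-cong (p , p′) (q , q′) = ∩-mono p q , ∩-mono p′ q′

∩-congʳ : ∀ {σ τ τ′} → IsT σ → τ ≅ τ′ → σ ∩ τ ≅ σ ∩ τ′
∩-congʳ s = ∩-cong (≅-refl s)

+-≅-congˡ : ∀ {ρ₁ ρ₂ ρ} → IsR ρ₁ → IsR ρ₂ → IsR ρ → ρ₁ ≅ ρ₂ → ρ₁ + ρ ≅ ρ₂ + ρ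
+-≅-congˡ r₁ r₂ r (p , q) = +-monoˡ r₁ r₂ r p , +-monoˡ r₂ r₁ r q

+-≅-congʳ : ∀ {ρ ρ₁ ρ₂} → IsR ρ → IsR ρ₁ → IsR ρ₂ → ρ₁ ≅ ρ₂ → ρ + ρ₁ ≅ ρ + ρ₂
+-≅-congʳ r r₁ r₂ (p , q) = +-congʳ r r₁ r₂ p q , +-congʳ r r₂ r₁ q p

-- ≅ is reflexive only on well-formed types, hence reasoning for partial relations.
module ≅-Reasoning where
  open import Relation.Binary.Reasoning.Base.Partial _≅_ ≅-trans public
    using (_IsRelatedTo_; begin_; _∎; step-≡-⟨)
  open import Relation.Binary.Reasoning.Base.Partial _≅_ ≅-trans
    using (∼-go)

  infixr 2 step-≅-⟩ step-≅-⟨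
  step-≅-⟩ : ∀ σ {τ υ} → τ IsRelatedTo υ → σ ≅ τ → σ IsRelatedTo υ
  step-≅-⟩ _ τ≅υ σ≅τ = ∼-go σ≅τ τ≅υ
  step-≅-⟨ : ∀ σ {τ υ} → τ IsRelatedTo υ → τ ≅ σ → σ IsRelatedTo υ
  step-≅-⟨ _ τ≅υ τ≅σ = ∼-go (≅-sym τ≅σ) τ≅υ
  syntax step-≅-⟩ σ τ≅υ σ≅τ = σ ≅⟨ σ≅τ ⟩ τ≅υ
  syntax step-≅-⟨ σ τ≅υ τ≅σ = σ ≅⟨ τ≅σ ⟨ τ≅υ

open ≅-Reasoning

Entries : Set
Entries = List (Label × Ty)

labels : Entries → List Label
labels = map proj₁

WfEntries : Entries → Set
WfEntries = All (IsT ∘ proj₂)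

recL-isR : ∀ {L} → WfEntries L → IsR (recL L)
recL-isR [] = ⟨⟩R
recL-isR {(x , _) ∷ []}    (t ∷ []) = fldR x t
recL-isR {(x , _) ∷ _ ∷ _} (t ∷ w)  = ∩R (fldR x t) (recL-isR w)

recL-isT : ∀ {L} → WfEntries L → IsT (recL L)
recL-isT = recT ∘ recL-isR

recL≤⟨⟩ : ∀ {L} → WfEntries L → recL L ≤ ⟨⟩
recL≤⟨⟩ [] = ≤-refl (recT ⟨⟩R)
recL≤⟨⟩ (t ∷ []) = fld-⟨⟩ t
recL≤⟨⟩ {(x , _) ∷ _ ∷ _} (t ∷ w) = ≤-trans (∩-lb₁ (recT (fldR x t)) (recL-isT w)) (fld-⟨⟩ t)

recL≤field : ∀ {L x a} → WfEntries L → (x , a) ∈ L → recL L ≤ ⟨ x ∶ a ⟩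
recL≤field (t ∷ []) (here refl) = ≤-refl (recT (fldR _ t))
recL≤field (t ∷ []) (there ())
recL≤field {_ ∷ _ ∷ _} (t ∷ w) (here refl) = ∩-lb₁ (recT (fldR _ t)) (recL-isT w)
recL≤field {_ ∷ _ ∷ _} (t ∷ w) (there e∈L) =
  ≤-trans (∩-lb₂ (recT (fldR _ t)) (recL-isT w)) (recL≤field w e∈L)

≤-recL : ∀ {σ} L → σ ≤ ⟨⟩ → (∀ {x a} → (x , a) ∈ L → σ ≤ ⟨ x ∶ a ⟩) → σ ≤ recL L
≤-recL [] σ≤⟨⟩ _ = σ≤⟨⟩
≤-recL (_ ∷ []) _ σ≤fields = σ≤fields (here refl)
≤-recL (_ ∷ L@(_ ∷ _)) σ≤⟨⟩ σ≤fields =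
  ∩-glb (σ≤fields (here refl)) (≤-recL L σ≤⟨⟩ (σ≤fields ∘ there))

recL-≤ : ∀ {L} M → WfEntries L → (∀ {x a} → (x , a) ∈ M → recL L ≤ ⟨ x ∶ a ⟩) → recL L ≤ recL M
recL-≤ M w = ≤-recL M (recL≤⟨⟩ w)

recL-antitone : ∀ {L M} → WfEntries L → M ⊆ L → recL L ≤ recL M
recL-antitone {M = M} w M⊆L = recL-≤ M w (recL≤field w ∘ M⊆L)

recL-cong : ∀ {L M} → WfEntries L → WfEntries M → L ⊆ M → M ⊆ L → recL L ≅ recL M
recL-cong wL wM L⊆M M⊆L = recL-antitone wL M⊆L , recL-antitone wM L⊆M

recL-++ : ∀ {L M} → WfEntries L → WfEntries M → recL (L ++ M) ≅ recL L ∩ recL M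
recL-++ {L} {M} wL wM =
  ∩-glb (recL-antitone wLM (xs⊆xs++ys L M)) (recL-antitone wLM (xs⊆ys++xs M L)) ,
  ≤-recL (L ++ M) (≤-trans (∩-lb₁ LT MT) (recL≤⟨⟩ wL)) bound
  where
  wLM : WfEntries (L ++ M)
  wLM = All.++⁺ wL wM
  LT : IsT (recL L)
  LT = recL-isT wL
  MT : IsT (recL M)
  MT = recL-isT wM
  bound : ∀ {x a} → (x , a) ∈ L ++ M → recL L ∩ recL M ≤ ⟨ x ∶ a ⟩
  bound e∈ with ∈-++⁻ L e∈
  ... | inj₁ e∈L = ≤-trans (∩-lb₁ LT MT) (recL≤field wL e∈L)
  ... | inj₂ e∈M = ≤-trans (∩-lb₂ LT MT) (recL≤field wM e∈M)

recL-∷ : ∀ {x a L} → IsT a → WfEntries L → recL ((x , a) ∷ L) ≅ ⟨ x ∶ a ⟩ ∩ recL L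
recL-∷ t w = recL-++ (t ∷ []) w

recL-swap : ∀ {u v L} → WfEntries (u ∷ v ∷ L) → recL (u ∷ v ∷ L) ≅ recL (v ∷ u ∷ L)
recL-swap (s ∷ t ∷ w) =
  recL-cong (s ∷ t ∷ w) (t ∷ s ∷ w) (⊆-reflexive-↭ (swap _ _ ↭-refl))
                                    (⊆-reflexive-↭ (swap _ _ ↭-refl))

recL-fuse : ∀ {x a b L} → IsT a → IsT b → WfEntries L →
            recL ((x , a) ∷ (x , b) ∷ L) ≅ recL ((x , a ∩ b) ∷ L)
recL-fuse {x} {a} {b} {L} ta tb w = recL-≤ _ wSplit fused≥ , recL-≤ _ wFused split≥
  where
  wSplit : WfEntries ((x , a) ∷ (x , b) ∷ L)
  wSplit = ta ∷ tb ∷ w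
  wFused : WfEntries ((x , a ∩ b) ∷ L)
  wFused = ∩T ta tb ∷ w
  fused≥ : ∀ {y c} → (y , c) ∈ (x , a ∩ b) ∷ L → recL ((x , a) ∷ (x , b) ∷ L) ≤ ⟨ y ∶ c ⟩
  fused≥ (here refl) = ≤-trans (∩-glb (recL≤field wSplit (here refl))
                                      (recL≤field wSplit (there (here refl))))
                               (fld-∩ ta tb)
  fused≥ (there e∈L) = recL≤field wSplit (there (there e∈L))
  split≥ : ∀ {y c} → (y , c) ∈ (x , a) ∷ (x , b) ∷ L → recL ((x , a ∩ b) ∷ L) ≤ ⟨ y ∶ c ⟩
  split≥ (here refl)          = ≤-trans (recL≤field wFused (here refl)) (fld-mono (∩-lb₁ ta tb))
  split≥ (there (here refl))  = ≤-trans (recL≤field wFused (here refl)) (fld-mono (∩-lb₂ ta tb))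
  split≥ (there (there e∈L))  = recL≤field wFused (there e∈L)

+-congʳ-recL-∷ : ∀ {ρ y b M} → IsR ρ → IsT b → WfEntries M →
                 ρ + recL ((y , b) ∷ M) ≅ ρ + (⟨ y ∶ b ⟩ ∩ recL M)
+-congʳ-recL-∷ r tb w = +-≅-congʳ r (recL-isR (tb ∷ w)) (∩R (fldR _ tb) (recL-isR w)) (recL-∷ tb w)

field+recL-present : ∀ {x a} M → IsT a → WfEntries M → x ∈ labels M →
                     ⟨ x ∶ a ⟩ + recL M ≅ recL M
field+recL-present {x} {a} ((y , b) ∷ M) ta (tb ∷ w) x∈ with x ≟ y | x∈
... | yes refl | _ = begin
  ⟨ x ∶ a ⟩ + recL ((x , b) ∷ M)    ≅⟨ +-congʳ-recL-∷ (fldR x ta) tb w ⟩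
  ⟨ x ∶ a ⟩ + (⟨ x ∶ b ⟩ ∩ recL M)  ≅⟨ ≐⇒≅ (+same ta tb (recL-isR w)) ⟩
  ⟨ x ∶ b ⟩ ∩ recL M                ≅⟨ recL-∷ tb w ⟨
  recL ((x , b) ∷ M)                ∎
... | no x≢y | here x≡y = ⊥-elim (x≢y x≡y)
... | no x≢y | there x∈M = begin
  ⟨ x ∶ a ⟩ + recL ((y , b) ∷ M)    ≅⟨ +-congʳ-recL-∷ (fldR x ta) tb w ⟩
  ⟨ x ∶ a ⟩ + (⟨ y ∶ b ⟩ ∩ recL M)  ≅⟨ ≐⇒≅ (+diff x≢y ta tb (recL-isR w)) ⟩
  ⟨ y ∶ b ⟩ ∩ (⟨ x ∶ a ⟩ + recL M)  ≅⟨ ∩-congʳ (recT (fldR y tb)) (field+recL-present M ta w x∈M) ⟩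
  ⟨ y ∶ b ⟩ ∩ recL M                ≅⟨ recL-∷ tb w ⟨
  recL ((y , b) ∷ M)                ∎

field+recL-absent : ∀ {x a} M → IsT a → WfEntries M → x ∉ labels M →
                    ⟨ x ∶ a ⟩ + recL M ≅ recL ((x , a) ∷ M)
field+recL-absent [] ta [] _ = ≐⇒≅ (+unitʳ (fldR _ ta))
field+recL-absent {x} {a} ((y , b) ∷ M) ta (tb ∷ w) x∉ = begin
  ⟨ x ∶ a ⟩ + recL ((y , b) ∷ M)    ≅⟨ +-congʳ-recL-∷ (fldR x ta) tb w ⟩
  ⟨ x ∶ a ⟩ + (⟨ y ∶ b ⟩ ∩ recL M)  ≅⟨ ≐⇒≅ (+diff (x∉ ∘ here) ta tb (recL-isR w)) ⟩
  ⟨ y ∶ b ⟩ ∩ (⟨ x ∶ a ⟩ + recL M)  ≅⟨ ∩-congʳ (recT (fldR y tb)) (field+recL-absent M ta w (x∉ ∘ there)) ⟩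
  ⟨ y ∶ b ⟩ ∩ recL ((x , a) ∷ M)    ≅⟨ recL-∷ tb (ta ∷ w) ⟨
  recL ((y , b) ∷ (x , a) ∷ M)      ≅⟨ recL-swap (tb ∷ ta ∷ w) ⟩
  recL ((x , a) ∷ (y , b) ∷ M)      ∎

absent? : (M : Entries) → Decidable (λ (e : Label × Ty) → proj₁ e ∉ labels M)
absent? M e = ¬? (proj₁ e ∈? labels M)

absentFrom : Entries → Entries → Entries
absentFrom M = filter (absent? M)

absentFrom-wf : ∀ {L} M → WfEntries L → WfEntries (absentFrom M L)
absentFrom-wf M = All.filter⁺ (absent? M)

field+recL : ∀ {x a} M → IsT a → WfEntries M →
             ⟨ x ∶ a ⟩ + recL M ≅ recL (absentFrom M ((x , a) ∷ []) ++ M)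
field+recL {x} M ta w with x ∈? labels M
... | yes x∈ = field+recL-present M ta w x∈
... | no x∉  = field+recL-absent M ta w x∉

recL-+ : ∀ L {M} → WfEntries L → WfEntries M → recL L + recL M ≅ recL (absentFrom M L ++ M)
recL-+ [] [] wM = ≐⇒≅ (+unitˡ (recL-isR wM))
recL-+ ((x , a) ∷ L) {M} (ta ∷ wL) wM = begin
  recL ((x , a) ∷ L) + recL M               ≅⟨ +-≅-congˡ (recL-isR (ta ∷ wL)) (∩R (fldR x ta) (recL-isR wL))
                                                         (recL-isR wM) (recL-∷ ta wL) ⟩
  (⟨ x ∶ a ⟩ ∩ recL L) + recL M             ≅⟨ ≐⇒≅ (+distr (fldR x ta) (recL-isR wL) (recL-isR wM)) ⟩
  (⟨ x ∶ a ⟩ + recL M) ∩ (recL L + recL M)  ≅⟨ ∩-cong (field+recL M ta wM) (recL-+ L wL wM) ⟩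
  recL (A₁ ++ M) ∩ recL (A₂ ++ M)           ≅⟨ recL-++ w₁M w₂M ⟨
  recL ((A₁ ++ M) ++ (A₂ ++ M))             ≅⟨ recL-cong (All.++⁺ w₁M w₂M) (All.++⁺ (All.++⁺ w₁ w₂) wM)
                                                         dedup dup ⟩
  recL ((A₁ ++ A₂) ++ M)                    ≡⟨ cong (recL ∘ (_++ M))
                                                    (filter-++ (absent? M) ((x , a) ∷ []) L) ⟨
  recL (absentFrom M ((x , a) ∷ L) ++ M)    ∎
  where
  A₁ A₂ : Entries
  A₁ = absentFrom M ((x , a) ∷ [])
  A₂ = absentFrom M L
  w₁ : WfEntries A₁
  w₁ = absentFrom-wf M (ta ∷ [])
  w₂ : WfEntries A₂
  w₂ = absentFrom-wf M wL
  w₁M : WfEntries (A₁ ++ M)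
  w₁M = All.++⁺ w₁ wM
  w₂M : WfEntries (A₂ ++ M)
  w₂M = All.++⁺ w₂ wM
  dedup : (A₁ ++ M) ++ (A₂ ++ M) ⊆ (A₁ ++ A₂) ++ M
  dedup e∈ with ∈-++⁻ (A₁ ++ M) e∈
  ... | inj₁ e∈₁ = ++⁺ˡ M (xs⊆xs++ys A₁ A₂) e∈₁
  ... | inj₂ e∈₂ = ++⁺ˡ M (xs⊆ys++xs A₂ A₁) e∈₂
  dup : (A₁ ++ A₂) ++ M ⊆ (A₁ ++ M) ++ (A₂ ++ M)
  dup e∈ with ∈-++⁻ (A₁ ++ A₂) e∈
  ... | inj₂ e∈M = ∈-++⁺ʳ (A₁ ++ M) (∈-++⁺ʳ A₂ e∈M)
  ... | inj₁ e∈A with ∈-++⁻ A₁ e∈A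
  ...   | inj₁ e∈A₁ = ∈-++⁺ˡ (∈-++⁺ˡ e∈A₁)
  ...   | inj₂ e∈A₂ = ∈-++⁺ʳ (A₁ ++ M) (∈-++⁺ˡ e∈A₂)

-- Merging repeated labels

addField : Label × Ty → Entries → Entries
addField e [] = e ∷ []
addField (x , a) ((y , b) ∷ L) with x ≟ y
... | yes _ = (y , a ∩ b) ∷ L
... | no _  = (y , b) ∷ addField (x , a) L

addField-wf : ∀ {x a L} → IsT a → WfEntries L → WfEntries (addField (x , a) L)
addField-wf ta [] = ta ∷ []
addField-wf {x} {L = (y , _) ∷ _} ta (tb ∷ w) with x ≟ y
... | yes _ = ∩T ta tb ∷ w
... | no _  = tb ∷ addField-wf ta w

labels-addField : ∀ {x a} L → labels (addField (x , a) L) ⊆ x ∷ labels L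
labels-addField [] z∈ = z∈
labels-addField {x} ((y , b) ∷ L) z∈ with x ≟ y
... | yes refl = there z∈
labels-addField ((y , b) ∷ L) (here z≡y)  | no _ = there (here z≡y)
labels-addField ((y , b) ∷ L) (there z∈′) | no _ with labels-addField L z∈′
...   | here z≡x  = here z≡x
...   | there z∈L = there (there z∈L)

addField-unique : ∀ {x a} L → Unique (labels L) → Unique (labels (addField (x , a) L))
addField-unique [] [] = [] ∷ []
addField-unique {x} ((y , b) ∷ L) (y∉L ∷ u) with x ≟ y
... | yes _  = y∉L ∷ u
... | no x≢y = All-resp-⊇ (labels-addField L) ((λ y≡x → x≢y (sym y≡x)) ∷ y∉L) ∷ addField-unique L u

recL-addField : ∀ {x a} L → IsT a → WfEntries L → recL ((x , a) ∷ L) ≅ recL (addField (x , a) L)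
recL-addField [] ta [] = ≅-refl (recT (fldR _ ta))
recL-addField {x} {a} ((y , b) ∷ L) ta (tb ∷ w) with x ≟ y
... | yes refl = recL-fuse ta tb w
... | no _ = begin
  recL ((x , a) ∷ (y , b) ∷ L)         ≅⟨ recL-swap (ta ∷ tb ∷ w) ⟩
  recL ((y , b) ∷ (x , a) ∷ L)         ≅⟨ recL-∷ tb (ta ∷ w) ⟩
  ⟨ y ∶ b ⟩ ∩ recL ((x , a) ∷ L)       ≅⟨ ∩-congʳ (recT (fldR y tb)) (recL-addField L ta w) ⟩
  ⟨ y ∶ b ⟩ ∩ recL (addField (x , a) L) ≅⟨ recL-∷ tb (addField-wf ta w) ⟨
  recL ((y , b) ∷ addField (x , a) L)  ∎

normalise : Entries → Entries
normalise = foldr addField []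

normalise-wf : ∀ {L} → WfEntries L → WfEntries (normalise L)
normalise-wf [] = []
normalise-wf (t ∷ w) = addField-wf t (normalise-wf w)

normalise-unique : ∀ L → Unique (labels (normalise L))
normalise-unique [] = []
normalise-unique (e ∷ L) = addField-unique (normalise L) (normalise-unique L)

recL-normalise : ∀ {L} → WfEntries L → recL L ≅ recL (normalise L)
recL-normalise [] = ≅-refl (recT ⟨⟩R)
recL-normalise {(x , a) ∷ L} (ta ∷ w) = begin
  recL ((x , a) ∷ L)                ≅⟨ recL-∷ ta w ⟩
  ⟨ x ∶ a ⟩ ∩ recL L                ≅⟨ ∩-congʳ (recT (fldR x ta)) (recL-normalise w) ⟩
  ⟨ x ∶ a ⟩ ∩ recL (normalise L)    ≅⟨ recL-∷ ta (normalise-wf w) ⟨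
  recL ((x , a) ∷ normalise L)      ≅⟨ recL-addField (normalise L) ta (normalise-wf w) ⟩
  recL (normalise ((x , a) ∷ L))    ∎

entriesOf : ∀ {ρ} → IsR ρ → Σ Entries λ L → WfEntries L × ρ ≅ recL L
entriesOf ⟨⟩R = [] , [] , ≅-refl (recT ⟨⟩R)
entriesOf (fldR l {σ} s) = (l , σ) ∷ [] , s ∷ [] , ≅-refl (recT (fldR l s))
entriesOf (+R r₁ r₂) with entriesOf r₁ | entriesOf r₂
... | L₁ , w₁ , ρ₁≅ | L₂ , w₂ , ρ₂≅ =
  absentFrom L₂ L₁ ++ L₂ , All.++⁺ (absentFrom-wf L₂ w₁) w₂ ,
  ≅-trans (≅-trans (+-≅-congˡ r₁ (recL-isR w₁) r₂ ρ₁≅)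
                   (+-≅-congʳ (recL-isR w₁) r₂ (recL-isR w₂) ρ₂≅))
          (recL-+ L₁ w₁ w₂)
entriesOf (∩R r₁ r₂) with entriesOf r₁ | entriesOf r₂
... | L₁ , w₁ , ρ₁≅ | L₂ , w₂ , ρ₂≅ =
  L₁ ++ L₂ , All.++⁺ w₁ w₂ , ≅-trans (∩-cong ρ₁≅ ρ₂≅) (≅-sym (recL-++ w₁ w₂))

normalForm : ∀ {ρ} → IsR ρ → Σ Entries λ L → Unique (labels L) × WfEntries L × ρ ≅ recL L
normalForm r with entriesOf r
... | L , w , ρ≅ = normalise L , normalise-unique L , normalise-wf w , ≅-trans ρ≅ (recL-normalise w)

-- Types as partial maps from labels to field types

infixr 7 _⊓_
_⊓_ : Maybe Ty → Maybe Ty → Maybe Ty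
just σ  ⊓ just τ  = just (σ ∩ τ)
just σ  ⊓ nothing = just σ
nothing ⊓ m       = m

fieldOf : Ty → Label → Maybe Ty
fieldOf ⟨ y ∶ σ ⟩ x = Maybe.map (λ _ → σ) (dec⇒maybe (x ≟ y))
fieldOf (σ ∩ τ)   x = fieldOf σ x ⊓ fieldOf τ x
fieldOf (ρ₁ + ρ₂) x = fieldOf ρ₂ x <∣> fieldOf ρ₁ x
fieldOf _         _ = nothing

infix 4 _≤ₘ_ _≈ₘ_
_≤ₘ_ : Maybe Ty → Maybe Ty → Set
_      ≤ₘ nothing = ⊤
nothing ≤ₘ just _ = ⊥
just σ ≤ₘ just τ  = σ ≤ τ

_≈ₘ_ : Maybe Ty → Maybe Ty → Set
m ≈ₘ n = m ≤ₘ n × n ≤ₘ m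

IsTₘ : Maybe Ty → Set
IsTₘ = Maybeᴬ.All IsT

⊓-isT : ∀ {m n} → IsTₘ m → IsTₘ n → IsTₘ (m ⊓ n)
⊓-isT (Maybeᴬ.just s) (Maybeᴬ.just t) = Maybeᴬ.just (∩T s t)
⊓-isT (Maybeᴬ.just s) Maybeᴬ.nothing  = Maybeᴬ.just s
⊓-isT Maybeᴬ.nothing  t              = t

<∣>-isT : ∀ {m n} → IsTₘ m → IsTₘ n → IsTₘ (m <∣> n)
<∣>-isT (Maybeᴬ.just s) _ = Maybeᴬ.just s
<∣>-isT Maybeᴬ.nothing  t = t

mutual
  fieldOf-isT : ∀ {σ} → IsT σ → ∀ x → IsTₘ (fieldOf σ x)
  fieldOf-isT (atomT _) _ = Maybeᴬ.nothing
  fieldOf-isT ωT        _ = Maybeᴬ.nothing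
  fieldOf-isT (⇒T _ _)  _ = Maybeᴬ.nothing
  fieldOf-isT (∩T s t)  x = ⊓-isT (fieldOf-isT s x) (fieldOf-isT t x)
  fieldOf-isT (recT r)  x = fieldOf-isR r x

  fieldOf-isR : ∀ {ρ} → IsR ρ → ∀ x → IsTₘ (fieldOf ρ x)
  fieldOf-isR ⟨⟩R        _ = Maybeᴬ.nothing
  fieldOf-isR (fldR y s) x with x ≟ y
  ... | yes _ = Maybeᴬ.just s
  ... | no _  = Maybeᴬ.nothing
  fieldOf-isR (+R r₁ r₂) x = <∣>-isT (fieldOf-isR r₂ x) (fieldOf-isR r₁ x)
  fieldOf-isR (∩R r₁ r₂) x = ⊓-isT (fieldOf-isR r₁ x) (fieldOf-isR r₂ x)

≤ₘ-refl : ∀ {m} → IsTₘ m → m ≤ₘ m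
≤ₘ-refl (Maybeᴬ.just s) = ≤-refl s
≤ₘ-refl Maybeᴬ.nothing  = tt

≈ₘ-reflexive : ∀ {m n} → IsTₘ m → m ≡ n → m ≈ₘ n
≈ₘ-reflexive s refl = ≤ₘ-refl s , ≤ₘ-refl s

≤ₘ-trans : ∀ m n o → m ≤ₘ n → n ≤ₘ o → m ≤ₘ o
≤ₘ-trans _        _        nothing  _ _ = tt
≤ₘ-trans (just _) (just _) (just _) p q = ≤-trans p q

⊓-lb₁ : ∀ {m n} → IsTₘ m → IsTₘ n → m ⊓ n ≤ₘ m
⊓-lb₁ (Maybeᴬ.just s) (Maybeᴬ.just t) = ∩-lb₁ s t
⊓-lb₁ (Maybeᴬ.just s) Maybeᴬ.nothing  = ≤-refl s
⊓-lb₁ Maybeᴬ.nothing  _              = tt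

⊓-lb₂ : ∀ {m n} → IsTₘ m → IsTₘ n → m ⊓ n ≤ₘ n
⊓-lb₂ (Maybeᴬ.just s) (Maybeᴬ.just t) = ∩-lb₂ s t
⊓-lb₂ Maybeᴬ.nothing  t              = ≤ₘ-refl t
⊓-lb₂ (Maybeᴬ.just s) Maybeᴬ.nothing  = tt

⊓-glb : ∀ m n o → m ≤ₘ n → m ≤ₘ o → m ≤ₘ n ⊓ o
⊓-glb (just _) (just _) (just _) p q = ∩-glb p q
⊓-glb _        (just _) nothing  p _ = p
⊓-glb _        nothing  _        _ q = q

<∣>-monoʳ : ∀ {m} n n′ → IsTₘ m → n ≤ₘ n′ → m <∣> n ≤ₘ m <∣> n′
<∣>-monoʳ _ _ (Maybeᴬ.just s) _ = ≤-refl s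
<∣>-monoʳ _ _ Maybeᴬ.nothing  p = p

<∣>-congˡ : ∀ {o} m n → IsTₘ o → m ≤ₘ n → n ≤ₘ m → m <∣> o ≤ₘ n <∣> o
<∣>-congˡ (just _) (just _) _ p _ = p
<∣>-congˡ nothing  nothing  o _ _ = ≤ₘ-refl o

<∣>-distribˡ-⊓ : ∀ {m n o} → IsTₘ m → IsTₘ n → IsTₘ o → m <∣> (n ⊓ o) ≈ₘ (m <∣> n) ⊓ (m <∣> o)
<∣>-distribˡ-⊓ (Maybeᴬ.just s) _ _ = ∩-glb (≤-refl s) (≤-refl s) , ∩-lb₁ s s
<∣>-distribˡ-⊓ Maybeᴬ.nothing  n o = ≈ₘ-reflexive (⊓-isT n o) refl

just⊓-<∣> : ∀ σ m n → (just σ ⊓ m) <∣> n ≡ just σ ⊓ m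
just⊓-<∣> _ (just _) _ = refl
just⊓-<∣> _ nothing  _ = refl

≐-fieldOf : ∀ {σ τ} → σ ≐ τ → ∀ x → fieldOf σ x ≈ₘ fieldOf τ x
≐-fieldOf (+unitʳ r) x = ≈ₘ-reflexive (fieldOf-isR r x) refl
≐-fieldOf (+unitˡ r) x = ≈ₘ-reflexive (<∣>-isT (fieldOf-isR r x) Maybeᴬ.nothing) (<∣>-identityʳ _)
≐-fieldOf (+assoc {ρ₁} {ρ₂} {ρ₃} r₁ r₂ r₃) x =
  ≈ₘ-reflexive (fieldOf-isR (+R (+R r₁ r₂) r₃) x)
               (sym (<∣>-assoc (fieldOf ρ₃ x) (fieldOf ρ₂ x) (fieldOf ρ₁ x)))
≐-fieldOf (+distr r₁ r₂ r₃) x = <∣>-distribˡ-⊓ (fieldOf-isR r₃ x) (fieldOf-isR r₁ x) (fieldOf-isR r₂ x)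
≐-fieldOf (+same {l = l} {σ} {τ} {ρ} s t r) x with x ≟ l
... | yes _ = ≈ₘ-reflexive (<∣>-isT (⊓-isT (Maybeᴬ.just t) (fieldOf-isR r x)) (Maybeᴬ.just s))
                           (just⊓-<∣> τ (fieldOf ρ x) (just σ))
... | no _  = ≈ₘ-reflexive (<∣>-isT (fieldOf-isR r x) Maybeᴬ.nothing) (<∣>-identityʳ _)
≐-fieldOf (+diff {l = l} {l′} {τ = τ} {ρ} l≢l′ s t r) x with x ≟ l′ | x ≟ l
... | yes refl | yes refl = ⊥-elim (l≢l′ refl)
... | yes _    | no _     =
  ≈ₘ-reflexive (<∣>-isT (⊓-isT (Maybeᴬ.just t) ρT) Maybeᴬ.nothing)
               (trans (<∣>-identityʳ _) (cong (just τ ⊓_) (sym (<∣>-identityʳ (fieldOf ρ x)))))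
  where ρT = fieldOf-isR r x
... | no _     | yes _    = ≈ₘ-reflexive (<∣>-isT (fieldOf-isR r x) (Maybeᴬ.just s)) refl
... | no _     | no _     = ≈ₘ-reflexive (<∣>-isT (fieldOf-isR r x) Maybeᴬ.nothing) refl

≤⇒≤ₘ : ∀ {σ τ} → σ ≤ τ → ∀ x → fieldOf σ x ≤ₘ fieldOf τ x
≤⇒≤ₘ (≤-refl s)     x = ≤ₘ-refl (fieldOf-isT s x)
≤⇒≤ₘ (≤-trans p q)  x = ≤ₘ-trans _ _ _ (≤⇒≤ₘ p x) (≤⇒≤ₘ q x)
≤⇒≤ₘ (≤-ω _)        _ = tt
≤⇒≤ₘ ω≤ω⇒ω          _ = tt
≤⇒≤ₘ (∩-lb₁ s t)    x = ⊓-lb₁ (fieldOf-isT s x) (fieldOf-isT t x)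
≤⇒≤ₘ (∩-lb₂ s t)    x = ⊓-lb₂ (fieldOf-isT s x) (fieldOf-isT t x)
≤⇒≤ₘ (∩-glb p q)    x = ⊓-glb _ _ _ (≤⇒≤ₘ p x) (≤⇒≤ₘ q x)
≤⇒≤ₘ (⇒-∩ _ _ _)    _ = tt
≤⇒≤ₘ (⇒-mono _ _)   _ = tt
≤⇒≤ₘ (fld-⟨⟩ _)     _ = tt
≤⇒≤ₘ (fld-∩ {l} s t) x with x ≟ l
... | yes _ = ≤-refl (∩T s t)
... | no _  = tt
≤⇒≤ₘ (fld-mono {l} p) x with x ≟ l
... | yes _ = p
... | no _  = tt
≤⇒≤ₘ (ax→ e) x = proj₁ (≐-fieldOf e x)
≤⇒≤ₘ (ax← e) x = proj₂ (≐-fieldOf e x)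
≤⇒≤ₘ (+-monoˡ _ _ r p) x = <∣>-monoʳ _ _ (fieldOf-isR r x) (≤⇒≤ₘ p x)
≤⇒≤ₘ (+-congʳ r _ _ p q) x = <∣>-congˡ _ _ (fieldOf-isR r x) (≤⇒≤ₘ p x) (≤⇒≤ₘ q x)

fieldOf-single-≡ : ∀ {x σ} → fieldOf ⟨ x ∶ σ ⟩ x ≡ just σ
fieldOf-single-≡ {x} with x ≟ x
... | yes _  = refl
... | no x≢x = ⊥-elim (x≢x refl)

fieldOf-single-≢ : ∀ {x y σ} → x ≢ y → fieldOf ⟨ y ∶ σ ⟩ x ≡ nothing
fieldOf-single-≢ {x} {y} x≢y with x ≟ y
... | yes x≡y = ⊥-elim (x≢y x≡y)
... | no _    = refl

fieldOf-recL-∉ : ∀ {x} L → x ∉ labels L → fieldOf (recL L) x ≡ nothing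
fieldOf-recL-∉ [] _ = refl
fieldOf-recL-∉ {x} ((y , b) ∷ []) x∉ = fieldOf-single-≢ {x} {y} {b} (x∉ ∘ here)
fieldOf-recL-∉ {x} ((y , b) ∷ e ∷ L) x∉ =
  cong₂ _⊓_ (fieldOf-single-≢ {x} {y} {b} (x∉ ∘ here)) (fieldOf-recL-∉ (e ∷ L) (x∉ ∘ there))

fieldOf-recL-∈ : ∀ {x a} L → Unique (labels L) → (x , a) ∈ L → fieldOf (recL L) x ≡ just a
fieldOf-recL-∈ {x} {a} (_ ∷ []) _ (here refl) = fieldOf-single-≡ {x} {a}
fieldOf-recL-∈ {x} {a} (_ ∷ e ∷ L) (y∉L ∷ _) (here refl) =
  cong₂ _⊓_ (fieldOf-single-≡ {x} {a}) (fieldOf-recL-∉ (e ∷ L) (All.All¬⇒¬Any y∉L))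
fieldOf-recL-∈ {x} ((y , b) ∷ e ∷ L) (y∉L ∷ u) (there xa∈L) =
  cong₂ _⊓_ (fieldOf-single-≢ {x} {y} {b} x≢y) (fieldOf-recL-∈ (e ∷ L) u xa∈L)
  where
  x≢y : x ≢ y
  x≢y refl = All.All¬⇒¬Any y∉L (∈-map⁺ proj₁ xa∈L)

recL-≤-inversion : ∀ {L M x b} → Unique (labels L) → Unique (labels M) →
                   recL L ≤ recL M → (x , b) ∈ M → ∃ λ a → (x , a) ∈ L × a ≤ b
recL-≤-inversion {L} {M} {x} uL uM L≤M xb∈M with x ∈? labels L
... | no x∉ = ⊥-elim (subst₂ _≤ₘ_ (fieldOf-recL-∉ L x∉) (fieldOf-recL-∈ M uM xb∈M) (≤⇒≤ₘ L≤M x))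
... | yes x∈ with ∈-map⁻ proj₁ x∈
...   | (_ , a) , xa∈L , refl =
  a , xa∈L , subst₂ _≤ₘ_ (fieldOf-recL-∈ L uL xa∈L) (fieldOf-recL-∈ M uM xb∈M) (≤⇒≤ₘ L≤M x)

-- Records indexed by an injective labelling

module _ {K : Set} (l : K → Label) (inj : Injective _≡_ _≡_ l) where

  private
    _≟ₖ_ : DecidableEquality K
    _≟ₖ_ = decInj l inj

  open DecMembership _≟ₖ_ using () renaming (_∈?_ to _∈ₖ?_)

  ∈-entries⁺ : ∀ {σ : K → Ty} {I i} → i ∈ I → (l i , σ i) ∈ entries l σ I
  ∈-entries⁺ {σ} = ∈-map⁺ (λ i → l i , σ i)

  ∈-entries⁻ : ∀ {σ : K → Ty} {I e} → e ∈ entries l σ I → ∃ λ i → i ∈ I × e ≡ (l i , σ i)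
  ∈-entries⁻ {σ} = ∈-map⁻ (λ i → l i , σ i)

  entries-wf : ∀ {σ I} → (∀ i → i ∈ I → IsT (σ i)) → WfEntries (entries l σ I)
  entries-wf w = All.map⁺ (tabulate (w _))

  entries-unique : ∀ {σ : K → Ty} {I} → Unique I → Unique (labels (entries l σ I))
  entries-unique {I = I} u = subst Unique (map-∘ I) (Unique.map⁺ inj u)

  ∈-labels-entries⁻ : ∀ {σ : K → Ty} {I j} → l j ∈ labels (entries l σ I) → j ∈ I
  ∈-labels-entries⁻ lj∈ with ∈-map⁻ proj₁ lj∈
  ... | _ , e∈ , lj≡ with ∈-entries⁻ e∈
  ...   | i , i∈I , refl = subst (_∈ _) (sym (inj lj≡)) i∈I

  ∈-minus⁺ : ∀ {I J i} → i ∈ I → i ∉ J → i ∈ minus _≟ₖ_ I J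
  ∈-minus⁺ {J = J} = ∈-filter⁺ (λ i → ¬? (i ∈ₖ? J))

  ∈-minus⁻ : ∀ I J {i} → i ∈ minus _≟ₖ_ I J → i ∈ I × i ∉ J
  ∈-minus⁻ I J = ∈-filter⁻ (λ i → ¬? (i ∈ₖ? J)) {xs = I}

  ∈-inter⁺ : ∀ {I J i} → i ∈ I → i ∈ J → i ∈ inter _≟ₖ_ I J
  ∈-inter⁺ {J = J} = ∈-filter⁺ (_∈ₖ? J)

  ∈-inter⁻ : ∀ I J {i} → i ∈ inter _≟ₖ_ I J → i ∈ I × i ∈ J
  ∈-inter⁻ I J = ∈-filter⁻ (_∈ₖ? J) {xs = I}

  recL-entries-≤⁻ : ∀ {I J σ τ} → Unique I → Unique J →
                    recL (entries l σ I) ≤ recL (entries l τ J) →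
                    (∀ j → j ∈ J → j ∈ I) × (∀ j → j ∈ J → σ j ≤ τ j)
  recL-entries-≤⁻ {I} {J} {σ} {τ} uI uJ I≤J = (λ j → proj₁ ∘ at j) , (λ j → proj₂ ∘ at j)
    where
    at : ∀ j → j ∈ J → j ∈ I × σ j ≤ τ j
    at j j∈J with recL-≤-inversion (entries-unique uI) (entries-unique uJ) I≤J (∈-entries⁺ j∈J)
    ... | _ , ja∈ , a≤τj with ∈-entries⁻ ja∈
    ...   | i , i∈I , ja≡ with ,-injective ja≡
    ...     | lj≡li , refl with inj lj≡li
    ...       | refl = i∈I , a≤τj

  recL-entries-≤⁺ : ∀ {I J σ τ} → (∀ i → i ∈ I → IsT (σ i)) →
                    (∀ j → j ∈ J → j ∈ I) × (∀ j → j ∈ J → σ j ≤ τ j) →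
                    recL (entries l σ I) ≤ recL (entries l τ J)
  recL-entries-≤⁺ {I} {J} {σ} {τ} wσ (J⊆I , σ≤τ) = recL-≤ _ (entries-wf wσ) below
    where
    below : ∀ {x a} → (x , a) ∈ entries l τ J → recL (entries l σ I) ≤ ⟨ x ∶ a ⟩
    below xa∈ with ∈-entries⁻ xa∈
    ... | j , j∈J , refl =
      ≤-trans (recL≤field (entries-wf wσ) (∈-entries⁺ (J⊆I j j∈J))) (fld-mono (σ≤τ j j∈J))

  module _ {I J : List K} {σ τ : K → Ty}
           (wσ : ∀ i → i ∈ I → IsT (σ i)) (wτ : ∀ j → j ∈ J → IsT (τ j)) where

    private
      Eσ Eτ A B C : Entries
      Eσ = entries l σ I
      Eτ = entries l τ J
      A  = entries l σ (minus _≟ₖ_ I J)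
      B  = entries l τ (minus _≟ₖ_ J I)
      C  = entries l (λ k → σ k ∩ τ k) (inter _≟ₖ_ I J)
      wEσ : WfEntries Eσ
      wEσ = entries-wf wσ
      wEτ : WfEntries Eτ
      wEτ = entries-wf wτ
      wA : WfEntries A
      wA = entries-wf (λ i → wσ i ∘ proj₁ ∘ ∈-minus⁻ I J)
      wB : WfEntries B
      wB = entries-wf (λ j → wτ j ∘ proj₁ ∘ ∈-minus⁻ J I)
      wC : WfEntries C
      wC = entries-wf (λ k k∈ → ∩T (wσ k (proj₁ (∈-inter⁻ I J k∈)))
                                   (wτ k (proj₂ (∈-inter⁻ I J k∈))))

    recL-entries-∩ : recL Eσ ∩ recL Eτ ≅ recL (A ++ B ++ C)
    recL-entries-∩ = begin
      recL Eσ ∩ recL Eτ   ≅⟨ recL-++ wEσ wEτ ⟨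
      recL (Eσ ++ Eτ)     ≅⟨ recL-≤ (A ++ B ++ C) wEστ merged≥ , recL-≤ (Eσ ++ Eτ) wABC split≥ ⟩
      recL (A ++ B ++ C)  ∎
      where
      wEστ : WfEntries (Eσ ++ Eτ)
      wEστ = All.++⁺ wEσ wEτ
      wABC : WfEntries (A ++ B ++ C)
      wABC = All.++⁺ wA (All.++⁺ wB wC)
      ∈C : ∀ {k} → k ∈ I → k ∈ J → (l k , σ k ∩ τ k) ∈ A ++ B ++ C
      ∈C k∈I k∈J = ∈-++⁺ʳ A (∈-++⁺ʳ B (∈-entries⁺ (∈-inter⁺ k∈I k∈J)))
      merged≥ : ∀ {x a} → (x , a) ∈ A ++ B ++ C → recL (Eσ ++ Eτ) ≤ ⟨ x ∶ a ⟩
      merged≥ xa∈ with ∈-++⁻ A xa∈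
      ... | inj₁ xa∈A with ∈-entries⁻ xa∈A
      ...   | i , i∈ , refl = recL≤field wEστ (∈-++⁺ˡ (∈-entries⁺ (proj₁ (∈-minus⁻ I J i∈))))
      merged≥ xa∈ | inj₂ xa∈BC with ∈-++⁻ B xa∈BC
      ... | inj₁ xa∈B with ∈-entries⁻ xa∈B
      ...   | j , j∈ , refl = recL≤field wEστ (∈-++⁺ʳ Eσ (∈-entries⁺ (proj₁ (∈-minus⁻ J I j∈))))
      merged≥ xa∈ | inj₂ xa∈BC | inj₂ xa∈C with ∈-entries⁻ xa∈C
      ... | k , k∈ , refl with ∈-inter⁻ I J k∈
      ...   | k∈I , k∈J =
        ≤-trans (∩-glb (recL≤field wEστ (∈-++⁺ˡ (∈-entries⁺ k∈I)))
                       (recL≤field wEστ (∈-++⁺ʳ Eσ (∈-entries⁺ k∈J))))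
                (fld-∩ (wσ k k∈I) (wτ k k∈J))
      split≥ : ∀ {x a} → (x , a) ∈ Eσ ++ Eτ → recL (A ++ B ++ C) ≤ ⟨ x ∶ a ⟩
      split≥ xa∈ with ∈-++⁻ Eσ xa∈
      ... | inj₁ xa∈Eσ with ∈-entries⁻ xa∈Eσ
      ...   | i , i∈I , refl with i ∈ₖ? J
      ...     | yes i∈J =
        ≤-trans (recL≤field wABC (∈C i∈I i∈J)) (fld-mono (∩-lb₁ (wσ i i∈I) (wτ i i∈J)))
      ...     | no i∉J  = recL≤field wABC (∈-++⁺ˡ (∈-entries⁺ (∈-minus⁺ i∈I i∉J)))
      split≥ xa∈ | inj₂ xa∈Eτ with ∈-entries⁻ xa∈Eτ
      ... | j , j∈J , refl with j ∈ₖ? I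
      ...   | yes j∈I =
        ≤-trans (recL≤field wABC (∈C j∈I j∈J)) (fld-mono (∩-lb₂ (wσ j j∈I) (wτ j j∈J)))
      ...   | no j∉I  = recL≤field wABC (∈-++⁺ʳ A (∈-++⁺ˡ (∈-entries⁺ (∈-minus⁺ j∈J j∉I))))

    recL-entries-+ : recL Eσ + recL Eτ ≅ recL (A ++ Eτ)
    recL-entries-+ = begin
      recL Eσ + recL Eτ              ≅⟨ recL-+ Eσ wEσ wEτ ⟩
      recL (absentFrom Eτ Eσ ++ Eτ)  ≅⟨ recL-cong (All.++⁺ (absentFrom-wf Eτ wEσ) wEτ) (All.++⁺ wA wEτ)
                                                  (++⁺ˡ Eτ absent⊆A) (++⁺ˡ Eτ A⊆absent) ⟩
      recL (A ++ Eτ)                 ∎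
      where
      absent⊆A : absentFrom Eτ Eσ ⊆ A
      absent⊆A e∈ with ∈-filter⁻ (absent? Eτ) {xs = Eσ} e∈
      ... | e∈Eσ , e∉Eτ with ∈-entries⁻ e∈Eσ
      ...   | i , i∈I , refl = ∈-entries⁺ (∈-minus⁺ i∈I (e∉Eτ ∘ ∈-map⁺ proj₁ ∘ ∈-entries⁺ {τ}))
      A⊆absent : A ⊆ absentFrom Eτ Eσ
      A⊆absent e∈ with ∈-entries⁻ e∈
      ... | i , i∈ , refl with ∈-minus⁻ I J i∈
      ...   | i∈I , i∉J = ∈-filter⁺ (absent? Eτ) (∈-entries⁺ {σ} i∈I) (i∉J ∘ ∈-labels-entries⁻ {τ})

lemma3p7 :
    (∀ {K : Set} (l : K → Label) (inj : Injective _≡_ _≡_ l)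
       (I J : List K) → Unique I → Unique J →
       (σ τ : K → Ty) →
       (∀ i → i ∈ I → IsT (σ i)) → (∀ j → j ∈ J → IsT (τ j)) →
       ((recL (entries l σ I) ≤ recL (entries l τ J) →
           (∀ j → j ∈ J → j ∈ I) × (∀ j → j ∈ J → σ j ≤ τ j))
        × ((∀ j → j ∈ J → j ∈ I) × (∀ j → j ∈ J → σ j ≤ τ j) →
           recL (entries l σ I) ≤ recL (entries l τ J)))
       × (recL (entries l σ I) ∩ recL (entries l τ J)
            ≅ recL (entries l σ (minus (decInj l inj) I J)
                    ++ entries l τ (minus (decInj l inj) J I)
                    ++ entries l (λ k → σ k ∩ τ k) (inter (decInj l inj) I J)))
       × (recL (entries l σ I) + recL (entries l τ J)
            ≅ recL (entries l σ (minus (decInj l inj) I J) ++ entries l τ J)))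
    × (∀ ρ → IsR ρ →
         Σ (List (Label × Ty)) (λ ls →
           Unique (map proj₁ ls) × All (λ e → IsT (proj₂ e)) ls × (ρ ≅ recL ls)))
lemma3p7 =
  (λ l inj I J uI uJ σ τ wσ wτ →
     (recL-entries-≤⁻ l inj uI uJ , recL-entries-≤⁺ l inj wσ) ,
     recL-entries-∩ l inj wσ wτ ,
     recL-entries-+ l inj wσ wτ) ,
  (λ ρ → normalForm)
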